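{- There exists an aperiodic infinite word that avoids $4$-anti-powers.
   Context: A $4$-anti-power is a word $u_1u_2u_3u_4$ with $u_1,\ldots,u_4$ non-empty words of the same length that are pairwise distinct. An infinite word avoids $4$-anti-powers if none of its factors (blocks of consecutive letters) is a $4$-anti-power. An infinite word is aperiodic if it is not of the form $vu^\omega$ with $v$ finite and $u$ finite non-empty. -}

module Defs where

open import Data.Nat using (ℕ; suc; _+_; _*_; _<_; _≤_)
open import Data.Fin using (Fin; toℕ)
open import Data.Product using (Σ; ∃; _×_)
open import Relation.Nullary using (¬_)
open import Relation.Binary.PropositionalEquality using (_≡_; _≢_)

InfWord : Set → Set
InfWord A = ℕ → A

-- The j-th block (j = 0,1,2,3) of length m of the factor of w starting at
-- position i is w[i + j*m .. i + j*m + m - 1].  Two blocks j, j' are equal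
-- as words iff they agree letter by letter.
SameBlock : {A : Set} → InfWord A → (i m j j' : ℕ) → Set
SameBlock w i m j j' = ∀ t → t < m → w (i + j * m + t) ≡ w (i + j' * m + t)

IsAntiPower4At : {A : Set} → InfWord A → (i m : ℕ) → Set
IsAntiPower4At w i m =
  1 ≤ m × (∀ (j j' : Fin 4) → toℕ j ≢ toℕ j' → ¬ SameBlock w i m (toℕ j) (toℕ j'))

Avoids4AntiPowers : {A : Set} → InfWord A → Set
Avoids4AntiPowers w = ∀ i m → ¬ IsAntiPower4At w i m

UltPeriodic : {A : Set} → InfWord A → Set
UltPeriodic w = Σ ℕ λ n → Σ ℕ λ p → 1 ≤ p × (∀ k → n ≤ k → w (k + p) ≡ w k)

Aperiodic : {A : Set} → InfWord A → Set
Aperiodic w = ¬ UltPeriodic w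

-- Take the characteristic word of the powers of 4.  Consecutive powers of 4
-- grow by a factor 4, whereas the window formed by the last three blocks of a
-- factor u₁u₂u₃u₄ of length 4m starting at i is [i + m, i + 4m), where the
-- ratio of endpoints is at most 4.  So at most one of u₂, u₃, u₄ contains a 1;
-- the other two are blocks of zeros and hence equal.  The same growth rules out
-- a period p: a power of 4 larger than p would be followed by another at
-- distance p.
module Submission where

open import Defs
open import Data.Nat using (ℕ; zero; suc; _+_; _*_; _^_; _<_; _≤_; z≤n; s≤s)
open import Data.Nat.Properties
open import Data.Nat.Tactic.RingSolver using (solve-∀)
open import Data.Fin using (Fin; #_)
open import Data.Empty using (⊥)
open import Data.Product using (Σ; ∃; _×_; _,_)
open import Relation.Nullary using (¬_; Dec; yes; no; contradiction)
open import Relation.Nullary.Decidable using (map′)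
open import Relation.Unary using (Pred; Decidable)
open import Relation.Binary.PropositionalEquality using (_≡_; refl; sym; trans; subst)
open import Level using (0ℓ)

Lacunary : Pred ℕ 0ℓ → Set
Lacunary S = ∀ {a b} → S a → S b → a < b → 4 * a ≤ b

Unbounded : Pred ℕ 0ℓ → Set
Unbounded S = ∀ n → ∃ λ a → n ≤ a × S a

i+4m≤4a : ∀ i m a → i + m ≤ a → i + 4 * m ≤ 4 * a
i+4m≤4a i m a i+m≤a = begin
  i + 4 * m       ≤⟨ +-monoˡ-≤ (4 * m) (m≤n*m i 4) ⟩
  4 * i + 4 * m   ≡⟨ sym (*-distribˡ-+ 4 i m) ⟩
  4 * (i + m)     ≤⟨ *-monoʳ-≤ 4 i+m≤a ⟩
  4 * a           ∎
  where open ≤-Reasoning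

block-start : ∀ i m {j} t → 1 ≤ j → i + m ≤ i + j * m + t
block-start i m {suc j} t _ = ≤-trans (+-monoʳ-≤ i (m≤m+n m (j * m))) (m≤m+n _ t)

block-before : ∀ i m {j j'} t → t < m → j < j' → i + j * m + t < i + j' * m
block-before i m {j} {j'} t t<m j<j' = begin-strict
  i + j * m + t   <⟨ +-monoʳ-< (i + j * m) t<m ⟩
  i + j * m + m   ≡⟨ shift i j m ⟩
  i + suc j * m   ≤⟨ +-monoʳ-≤ i (*-monoˡ-≤ m j<j') ⟩
  i + j' * m      ∎
  where
  open ≤-Reasoning
  shift : ∀ i j m → i + j * m + m ≡ i + suc j * m
  shift = solve-∀

module LacunaryWord {S : Pred ℕ 0ℓ} (S? : Decidable S) (lacunary : Lacunary S) where

  χ : InfWord (Fin 2)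
  χ k with S? k
  ... | yes _ = # 1
  ... | no _  = # 0

  χ-∈ : ∀ {k} → S k → χ k ≡ # 1
  χ-∈ {k} Sk with S? k
  ... | yes _  = refl
  ... | no ¬Sk = contradiction Sk ¬Sk

  χ-∉ : ∀ {k} → ¬ S k → χ k ≡ # 0
  χ-∉ {k} ¬Sk with S? k
  ... | yes Sk = contradiction Sk ¬Sk
  ... | no _   = refl

  χ≡1⇒∈ : ∀ {k} → χ k ≡ # 1 → S k
  χ≡1⇒∈ {k} _ with S? k
  χ≡1⇒∈ refl | yes Sk = Sk

  not-in-short-window : ∀ {i m a b} → S a → S b → i + m ≤ a → a < b → b < i + 4 * m → ⊥
  not-in-short-window {i} {m} {a} Sa Sb i+m≤a a<b b<i+4m =
    <⇒≱ b<i+4m (≤-trans (i+4m≤4a i m a i+m≤a) (lacunary Sa Sb a<b))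

  BlockMeets : (i m j : ℕ) → Set
  BlockMeets i m j = ∃ λ t → t < m × S (i + j * m + t)

  blockMeets? : ∀ i m j → Dec (BlockMeets i m j)
  blockMeets? i m j = anyUpTo? (λ t → S? (i + j * m + t)) m

  at-most-one-block-meets : ∀ i m j j' → 1 ≤ j → j < j' → j' < 4 →
                            BlockMeets i m j → ¬ BlockMeets i m j'
  at-most-one-block-meets i m j j' 1≤j j<j' j'<4 (t , t<m , Sa) (t' , t'<m , Sb) =
    not-in-short-window {i} {m} Sa Sb
      (block-start i m t 1≤j)
      (<-≤-trans (block-before i m t t<m j<j') (m≤m+n _ t'))
      (block-before i m t' t'<m j'<4)

  missed-blocks-equal : ∀ i m j j' → ¬ BlockMeets i m j → ¬ BlockMeets i m j' →
                        SameBlock χ i m j j'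
  missed-blocks-equal _ _ _ _ ¬meets ¬meets' t t<m =
    trans (χ-∉ (λ St → ¬meets (t , t<m , St))) (sym (χ-∉ (λ St → ¬meets' (t , t<m , St))))

  χ-avoids : Avoids4AntiPowers χ
  χ-avoids i m (_ , distinct) with blockMeets? i m 1 | blockMeets? i m 2
  ... | yes meets₁ | _ =
    distinct (# 2) (# 3) (λ ()) (missed-blocks-equal i m 2 3
      (at-most-one-block-meets i m 1 2 ≤-refl ≤-refl (n≤1+n 3) meets₁)
      (at-most-one-block-meets i m 1 3 ≤-refl (n≤1+n 2) ≤-refl meets₁))
  ... | no ¬meets₁ | no ¬meets₂ =
    distinct (# 1) (# 2) (λ ()) (missed-blocks-equal i m 1 2 ¬meets₁ ¬meets₂)
  ... | no ¬meets₁ | yes meets₂ =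
    distinct (# 1) (# 3) (λ ()) (missed-blocks-equal i m 1 3 ¬meets₁
      (at-most-one-block-meets i m 2 3 (s≤s z≤n) ≤-refl ≤-refl meets₂))

  χ-aperiodic : Unbounded S → Aperiodic χ
  χ-aperiodic unbounded (n , p , 1≤p , periodic) with unbounded (n + suc p)
  ... | q , n+1+p≤q , Sq = <⇒≱ q+p<4q (lacunary Sq Sq+p (m<m+n q 1≤p))
    where
    p<q : p < q
    p<q = ≤-trans (m≤n+m (suc p) n) n+1+p≤q
    q+p<4q : q + p < 4 * q
    q+p<4q = +-monoʳ-< q (<-≤-trans p<q (m≤m+n q (2 * q)))
    Sq+p : S (q + p)
    Sq+p = χ≡1⇒∈ (trans (periodic q (≤-trans (m≤m+n n (suc p)) n+1+p≤q)) (χ-∈ Sq))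

PowerOf4 : Pred ℕ 0ℓ
PowerOf4 k = ∃ λ t → 4 ^ t ≡ k

n<4^n : ∀ n → n < 4 ^ n
n<4^n zero    = s≤s z≤n
n<4^n (suc n) = ≤-<-trans (n<4^n n) (^-monoʳ-< 4 (s≤s (s≤s z≤n)) (n<1+n n))

powerOf4? : Decidable PowerOf4
powerOf4? k = map′ (λ (t , _ , 4^t≡k) → t , 4^t≡k)
                   (λ (t , 4^t≡k) → t , subst (t <_) 4^t≡k (n<4^n t) , 4^t≡k)
                   (anyUpTo? (λ t → 4 ^ t ≟ k) k)

powerOf4-lacunary : Lacunary PowerOf4
powerOf4-lacunary (r , refl) (s , refl) 4^r<4^s =
  ^-monoʳ-≤ 4 {suc r} {s} (≰⇒> λ s≤r → <⇒≱ 4^r<4^s (^-monoʳ-≤ 4 s≤r))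

powerOf4-unbounded : Unbounded PowerOf4
powerOf4-unbounded n = 4 ^ n , <⇒≤ (n<4^n n) , n , refl

open LacunaryWord powerOf4? powerOf4-lacunary

proposition12 : Σ ℕ λ k → Σ (InfWord (Fin k)) λ w → Aperiodic w × Avoids4AntiPowers w
proposition12 = 2 , χ , χ-aperiodic powerOf4-unbounded , χ-avoids
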